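{- For $n\ge3$, the number of $132$-avoiding permutations $\sigma=\sigma_1\cdots\sigma_n$ of $\{1,\dots,n\}$ with $\sigma_1\neq n$ and exactly three indices $i$ satisfying $|\sigma_i-\sigma_{i+1}|=1$ or $|\sigma_{i-1}-\sigma_i|=1$ is $F_{n-2}$; the same holds with the condition $\sigma_1\ne n$ replaced by $\sigma_n\neq n$.
   Context: A permutation $\sigma$ avoids $132$ if there are no indices $i<j<k$ with $\sigma_i<\sigma_k<\sigma_j$. Conditions involving nonexistent entries $\sigma_0,\sigma_{n+1}$ are ignored. The Fibonacci numbers are defined by $F_0=F_1=1$ and $F_n=F_{n-1}+F_{n-2}$ for $n\ge2$. -}

module Defs where

open import Data.Nat using (ℕ; zero; suc; _+_; _∸_; _≤_; _<_; ∣_-_∣)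
import Data.Nat.Properties as ℕP
open import Data.Fin using (Fin; toℕ)
import Data.Fin.Properties as FinP
open import Data.Vec using (Vec; lookup)
open import Data.List using (List; filter; length)
open import Data.Product using (Σ; ∃; _×_; _,_)
open import Data.Sum using (_⊎_)
open import Data.Bool using (T)
open import Relation.Nullary using (¬_; Dec)
open import Relation.Nullary.Decidable using (⌊_⌋; ¬?; _×-dec_; _⊎-dec_; _→-dec_)
open import Relation.Binary.PropositionalEquality using (_≡_; _≢_)
open import Function.Bundles using (_↔_)

F : ℕ → ℕ
F zero = 1
F (suc zero) = 1
F (suc (suc n)) = F (suc n) + F n

-- A word σ = σ₁⋯σₙ (stored as a length-n vector, position i : Fin n
-- standing for index toℕ i + 1) is a permutation of {1,…,n}:
-- every entry lies in {1,…,n} and the entries are pairwise distinct.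
IsPerm : ∀ {n} → Vec ℕ n → Set
IsPerm {n} σ = (∀ i → 1 ≤ lookup σ i × lookup σ i ≤ n)
             × (∀ i j → lookup σ i ≡ lookup σ j → i ≡ j)

Avoids132 : ∀ {n} → Vec ℕ n → Set
Avoids132 {n} σ = ∀ (i j k : Fin n) → toℕ i < toℕ j → toℕ j < toℕ k →
                  ¬ (lookup σ i < lookup σ k × lookup σ k < lookup σ j)

-- Index i satisfies |σᵢ − σᵢ₊₁| = 1 or |σᵢ₋₁ − σᵢ| = 1
-- (conditions on nonexistent entries σ₀, σₙ₊₁ are ignored, i.e. false).
AdjIndex : ∀ {n} → Vec ℕ n → Fin n → Set
AdjIndex {n} σ i =
    (∃ λ (j : Fin n) → toℕ j ≡ suc (toℕ i) × ∣ lookup σ i - lookup σ j ∣ ≡ 1)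
  ⊎ (∃ λ (j : Fin n) → toℕ i ≡ suc (toℕ j) × ∣ lookup σ j - lookup σ i ∣ ≡ 1)

IsPerm? : ∀ {n} (σ : Vec ℕ n) → Dec (IsPerm σ)
IsPerm? {n} σ =
  FinP.all? (λ i → (1 ℕP.≤? lookup σ i) ×-dec (lookup σ i ℕP.≤? n))
  ×-dec FinP.all? (λ i → FinP.all? (λ j →
          (lookup σ i ℕP.≟ lookup σ j) →-dec (i FinP.≟ j)))

Avoids132? : ∀ {n} (σ : Vec ℕ n) → Dec (Avoids132 σ)
Avoids132? σ = FinP.all? λ i → FinP.all? λ j → FinP.all? λ k →
  (toℕ i ℕP.<? toℕ j) →-dec ((toℕ j ℕP.<? toℕ k) →-dec
    ¬? ((lookup σ i ℕP.<? lookup σ k) ×-dec (lookup σ k ℕP.<? lookup σ j)))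

AdjIndex? : ∀ {n} (σ : Vec ℕ n) (i : Fin n) → Dec (AdjIndex σ i)
AdjIndex? σ i =
      FinP.any? (λ j → (toℕ j ℕP.≟ suc (toℕ i)) ×-dec (∣ lookup σ i - lookup σ j ∣ ℕP.≟ 1))
  ⊎-dec FinP.any? (λ j → (toℕ i ℕP.≟ suc (toℕ j)) ×-dec (∣ lookup σ j - lookup σ i ∣ ℕP.≟ 1))

numAdj : ∀ {n} → Vec ℕ n → ℕ
numAdj {n} σ = length (filter (AdjIndex? σ) (Data.List.Base.allFin n))
  where import Data.List.Base

FirstNotMax : ∀ {n} → Vec ℕ n → Set
FirstNotMax {n} σ = ∀ (i : Fin n) → toℕ i ≡ 0 → lookup σ i ≢ n

LastNotMax : ∀ {n} → Vec ℕ n → Set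
LastNotMax {n} σ = ∀ (i : Fin n) → toℕ i ≡ n ∸ 1 → lookup σ i ≢ n

FirstNotMax? : ∀ {n} (σ : Vec ℕ n) → Dec (FirstNotMax σ)
FirstNotMax? {n} σ = FinP.all? λ i → (toℕ i ℕP.≟ 0) →-dec ¬? (lookup σ i ℕP.≟ n)

LastNotMax? : ∀ {n} (σ : Vec ℕ n) → Dec (LastNotMax σ)
LastNotMax? {n} σ = FinP.all? λ i → (toℕ i ℕP.≟ n ∸ 1) →-dec ¬? (lookup σ i ℕP.≟ n)

-- The conditions are packaged as booleans
-- (via ⌊_⌋ of the decision procedures) so that membership proofs are
-- unique and "the number of such σ is k" can be expressed as a bijection
-- of the subtype with Fin k.
Good₁ : ∀ {n} → Vec ℕ n → Set
Good₁ σ = T ⌊ IsPerm? σ ×-dec Avoids132? σ ×-dec FirstNotMax? σ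
              ×-dec (numAdj σ ℕP.≟ 3) ⌋

Good₂ : ∀ {n} → Vec ℕ n → Set
Good₂ σ = T ⌊ IsPerm? σ ×-dec Avoids132? σ ×-dec LastNotMax? σ
              ×-dec (numAdj σ ℕP.≟ 3) ⌋

-- A 132-avoiding permutation of an interval is α M β with M its maximum and α above β, so α
-- and β are again 132-avoiding permutations of intervals; by induction along this splitting,
-- such a permutation of length ≥ 2 has at least two adjacency indices.  For n ≥ 5 a 132-avoider
-- of [1, n] with exactly three adjacency indices therefore has one of the shapes n β, α n or
-- (α + 1) n 1, with β resp. α of the same kind, and the neighbour of n is not n − 1, since that
-- pair would add two adjacency indices to the two of the rest.  Counting by shape, the numbers
-- a(n), b(n) of such σ with σ₁ ≠ n, resp. σₙ ≠ n, satisfy a(n) = b(n − 1) + b(n − 2) and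
-- b(n) = a(n − 1) + b(n − 2), and a = b = 1, 2 at n = 3, 4.
module Submission where

open import Defs

open import Data.Bool using (Bool; true; false; _∨_; T)
open import Data.Bool.Properties using (∨-identityʳ; T-irrelevant)
open import Data.Empty using (⊥-elim)
open import Data.Fin using (Fin; zero; suc; toℕ)
import Data.Fin.Properties as Fin
open import Data.Fin.Properties using (+↔⊎)
open import Data.List using (List; []; _∷_; _++_; _∷ʳ_; [_]; length; map; filter; tabulate;
  cartesianProductWith; applyUpTo)
open import Data.List.Properties using (length-++; length-map; ∷ʳ-++; ∷ʳ-injective)
import Data.List.Properties as List
open import Data.List.Membership.Propositional using (_∈_)
open import Data.List.Membership.Propositional.Properties
  using (∈-∃++; ∈-cartesianProductWith⁺; ∈-applyUpTo⁺)
open import Data.List.Relation.Unary.All as All using (All; []; _∷_)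
import Data.List.Relation.Unary.All.Properties as All
open import Data.List.Relation.Unary.All.Properties using (¬Any⇒All¬)
open import Data.List.Relation.Unary.AllPairs as AllPairs using (AllPairs; []; _∷_)
import Data.List.Relation.Unary.AllPairs.Properties as AllPairs
open import Data.List.Relation.Unary.Any using (here)
open import Data.List.Relation.Unary.Unique.Propositional using (Unique)
open import Data.Nat
import Data.Nat as Nat
open import Data.Nat.Induction using (<-wellFounded)
open import Data.Nat.Properties
open import Data.List.Membership.DecPropositional _≟_ using (_∈?_)
open import Data.Product using (Σ; ∃; _×_; _,_; proj₁; proj₂)
open import Data.Sum using (_⊎_; inj₁; inj₂)
import Data.Sum
open import Data.Sum.Function.Propositional using (_⊎-↔_)
open import Data.Unit using (⊤; tt)
open import Data.Vec using (Vec; []; _∷_; lookup; toList) renaming (_∷ʳ_ to _∷ʳᵛ_)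
import Data.Vec as Vec
open import Data.Vec.Properties using (length-toList)
import Data.Vec.Properties as Vec
import Data.Vec.Relation.Unary.All.Properties as VecAll
open import Function using (_∘_; id; case_of_)
open import Function.Bundles using (_⇔_; mk⇔; module Equivalence; _↔_; mk⤖)
open import Function.Consequences.Propositional using (strictlySurjective⇒surjective)
open import Function.Properties.Bijection using (⤖⇒↔)
open import Function.Properties.Inverse using (↔-sym; ↔-trans)
open import Induction.WellFounded using (Acc; acc)
open import Relation.Binary.PropositionalEquality hiding ([_])
open import Relation.Nullary using (¬_; Dec; does; yes; no)
open import Relation.Nullary.Decidable
  using (T?; ⌊_⌋; dec-true; dec-false; _⊎-dec_; _×-dec_; _→-dec_; toWitness; fromWitness; from-yes)
open import Relation.Unary using (Decidable)

-- Adjacency indices of lists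

adjacent : ℕ → ℕ → Bool
adjacent x y = does (∣ x - y ∣ ≟ 1)

bit : Bool → ℕ
bit true = 1
bit false = 0

-- The flag says whether the head is already adjacent to an entry on its left.
adjCount : Bool → List ℕ → ℕ
adjCount b [] = 0
adjCount b (x ∷ []) = bit b
adjCount b (x ∷ y ∷ l) = bit (b ∨ adjacent x y) + adjCount (adjacent x y) (y ∷ l)

#adj : List ℕ → ℕ
#adj = adjCount false

last⁺ : ℕ → List ℕ → ℕ
last⁺ x [] = x
last⁺ _ (y ∷ l) = last⁺ y l

last⁺-∷ʳ : ∀ x u y → last⁺ x (u ∷ʳ y) ≡ y
last⁺-∷ʳ x [] y = refl
last⁺-∷ʳ x (z ∷ u) y = last⁺-∷ʳ z u y

last⁺-map-suc : ∀ x u → last⁺ (suc x) (map suc u) ≡ suc (last⁺ x u)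
last⁺-map-suc x [] = refl
last⁺-map-suc x (y ∷ u) = last⁺-map-suc y u

bit-∨ˡ : ∀ p q → bit p ≤ bit (p ∨ q)
bit-∨ˡ true q = ≤-refl
bit-∨ˡ false q = z≤n

bit-∨ʳ : ∀ p q → bit q ≤ bit (p ∨ q)
bit-∨ʳ true true = ≤-refl
bit-∨ʳ true false = z≤n
bit-∨ʳ false q = ≤-refl

#adj≤adjCount : ∀ b l → #adj l ≤ adjCount b l
#adj≤adjCount b [] = ≤-refl
#adj≤adjCount b (x ∷ []) = z≤n
#adj≤adjCount b (x ∷ y ∷ l) = +-monoˡ-≤ _ (bit-∨ʳ b (adjacent x y))

adjCount-++ : ∀ b u v → adjCount b u + #adj v ≤ adjCount b (u ++ v)
adjCount-++ b [] v = #adj≤adjCount b v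
adjCount-++ b (x ∷ []) [] = ≤-reflexive (+-identityʳ _)
adjCount-++ b (x ∷ []) (y ∷ v) =
  +-mono-≤ (bit-∨ˡ b (adjacent x y)) (#adj≤adjCount (adjacent x y) (y ∷ v))
adjCount-++ b (x ∷ y ∷ u) v = begin
  bit c + adjCount (adjacent x y) (y ∷ u) + #adj v   ≡⟨ +-assoc (bit c) _ _ ⟩
  bit c + (adjCount (adjacent x y) (y ∷ u) + #adj v) ≤⟨ +-monoʳ-≤ (bit c) (adjCount-++ _ (y ∷ u) v) ⟩
  bit c + adjCount (adjacent x y) (y ∷ u ++ v)       ∎
  where
  open ≤-Reasoning
  c : Bool
  c = b ∨ adjacent x y

#adj-++ : ∀ {u v m n} → m ≤ #adj u → n ≤ #adj v → m + n ≤ #adj (u ++ v)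
#adj-++ {u} {v} m≤ n≤ = ≤-trans (+-mono-≤ m≤ n≤) (adjCount-++ false u v)

adjCount-join : ∀ b x u y v → adjacent (last⁺ x u) y ≡ false →
  adjCount b (x ∷ u ++ y ∷ v) ≡ adjCount b (x ∷ u) + #adj (y ∷ v)
adjCount-join b x [] y v e rewrite e | ∨-identityʳ b = refl
adjCount-join b x (z ∷ u) y v e = begin
  bit c + adjCount (adjacent x z) (z ∷ u ++ y ∷ v)            ≡⟨ cong (bit c +_) (adjCount-join _ z u y v e) ⟩
  bit c + (adjCount (adjacent x z) (z ∷ u) + #adj (y ∷ v))   ≡⟨ +-assoc (bit c) _ _ ⟨
  bit c + adjCount (adjacent x z) (z ∷ u) + #adj (y ∷ v)     ∎
  where
  open ≡-Reasoning
  c : Bool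
  c = b ∨ adjacent x z

adjCount-map-suc : ∀ b u → adjCount b (map suc u) ≡ adjCount b u
adjCount-map-suc b [] = refl
adjCount-map-suc b (x ∷ []) = refl
adjCount-map-suc b (x ∷ y ∷ u) = cong (bit (b ∨ adjacent x y) +_) (adjCount-map-suc _ (y ∷ u))

∣n-1+n∣≡1 : ∀ n → ∣ n - suc n ∣ ≡ 1
∣n-1+n∣≡1 zero = refl
∣n-1+n∣≡1 (suc n) = ∣n-1+n∣≡1 n

adjacent-suc : ∀ n → adjacent n (suc n) ≡ true
adjacent-suc n rewrite ∣n-1+n∣≡1 n = refl

adjacent-suc˘ : ∀ n → adjacent (suc n) n ≡ true
adjacent-suc˘ n rewrite ∣-∣-comm (suc n) n | ∣n-1+n∣≡1 n = refl

¬adjacent-< : ∀ x y → 2 + x ≤ y → adjacent x y ≡ false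
¬adjacent-< zero (suc zero) (s≤s ())
¬adjacent-< zero (suc (suc y)) _ = refl
¬adjacent-< (suc x) (suc y) (s≤s le) = ¬adjacent-< x y le

¬adjacent-> : ∀ x y → 2 + y ≤ x → adjacent x y ≡ false
¬adjacent-> x y le rewrite ∣-∣-comm x y = ¬adjacent-< y x le

¬adjacent-top : ∀ {x m} → x ≤ suc m → x ≢ suc m → adjacent x (suc (suc m)) ≡ false
¬adjacent-top {x} x≤ x≢ = ¬adjacent-< x _ (s≤s (s≤s (≤-pred (≤∧≢⇒< x≤ x≢))))

¬adjacent-top˘ : ∀ {x m} → x ≤ suc m → x ≢ suc m → adjacent (suc (suc m)) x ≡ false
¬adjacent-top˘ {x} x≤ x≢ = ¬adjacent-> _ x (s≤s (s≤s (≤-pred (≤∧≢⇒< x≤ x≢))))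

#adj-pair : ∀ n → #adj (n ∷ suc n ∷ []) ≡ 2
#adj-pair n rewrite adjacent-suc n = refl

#adj-pair˘ : ∀ n → #adj (suc n ∷ n ∷ []) ≡ 2
#adj-pair˘ n rewrite adjacent-suc˘ n = refl

2≤#adj-∷-suc : ∀ x w → 2 ≤ #adj (x ∷ suc x ∷ w)
2≤#adj-∷-suc x w = #adj-++ {x ∷ suc x ∷ []} {w} {n = 0} (≤-reflexive (sym (#adj-pair x))) z≤n

#adj-top-1 : ∀ j → #adj (suc (suc (suc j)) ∷ 1 ∷ []) ≡ 0
#adj-top-1 j rewrite ¬adjacent-> (suc (suc (suc j))) 1 (s≤s (s≤s (s≤s z≤n))) = refl

AllPairs-++⁻ : ∀ {A : Set} {R : A → A → Set} xs {ys} → AllPairs R (xs ++ ys) →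
  AllPairs R xs × AllPairs R ys × All (λ x → All (R x) ys) xs
AllPairs-++⁻ [] p = [] , p , []
AllPairs-++⁻ (x ∷ xs) (px ∷ p) with AllPairs-++⁻ xs p
... | pxs , pys , across = All.++⁻ˡ xs px ∷ pxs , pys , All.++⁻ʳ xs px ∷ across

All-remove : ∀ {P : ℕ → Set} u {y w} → All P (u ++ y ∷ w) → All P (u ++ w)
All-remove u p with All.++⁻ u p
... | pu , _ ∷ pw = All.++⁺ pu pw

Unique-remove : ∀ (u : List ℕ) {y w} → Unique (u ++ y ∷ w) → Unique (u ++ w) × All (y ≢_) (u ++ w)
Unique-remove u p with AllPairs-++⁻ u p
... | pu , y∉w ∷ pw , across =
  AllPairs.++⁺ pu pw (All.map All.tail across) ,
  All.++⁺ (All.map (≢-sym ∘ All.head) across) y∉w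

length-remove : ∀ u (y : ℕ) w → length (u ++ y ∷ w) ≡ suc (length (u ++ w))
length-remove [] y w = refl
length-remove (x ∷ u) y w = cong suc (length-remove u y w)

InRange : ℕ → ℕ → ℕ → Set
InRange a b x = a ≤ x × x < b

inRange-shrink : ∀ {a b x} → InRange a (suc b) x → x ≢ b → InRange a b x
inRange-shrink (a≤x , x<1+b) x≢b = a≤x , ≤∧≢⇒< (≤-pred x<1+b) x≢b

inRange-shrink˘ : ∀ {a b x} → InRange a (suc b) x → b ≢ x → InRange a b x
inRange-shrink˘ r b≢x = inRange-shrink r (≢-sym b≢x)

unique-inRange⇒length≤ : ∀ a d l → Unique l → All (InRange a (d + a)) l → length l ≤ d
unique-inRange⇒length≤ a zero [] _ _ = z≤n
unique-inRange⇒length≤ a zero (x ∷ l) _ ((a≤x , x<a) ∷ _) = ⊥-elim (<-irrefl refl (<-≤-trans x<a a≤x))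
unique-inRange⇒length≤ a (suc d) l ul rl with d + a ∈? l
... | no d+a∉l =
  m≤n⇒m≤1+n (unique-inRange⇒length≤ a d l ul
    (All.zipWith (λ (r , ne) → inRange-shrink˘ r ne) (rl , ¬Any⇒All¬ l d+a∉l)))
... | yes d+a∈l with ∈-∃++ d+a∈l
...   | u , w , l≡ = subst (λ l → length l ≤ suc d) (sym l≡)
  (withoutTop u w (subst Unique l≡ ul) (subst (All (InRange a (suc d + a))) l≡ rl))
  where
  withoutTop : ∀ u w → Unique (u ++ d + a ∷ w) → All (InRange a (suc d + a)) (u ++ d + a ∷ w) →
    length (u ++ d + a ∷ w) ≤ suc d
  withoutTop u w ul rl =
    let ul′ , d+a∉ = Unique-remove u ul in
    subst (_≤ suc d) (sym (length-remove u (d + a) w)) (s≤s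
      (unique-inRange⇒length≤ a d (u ++ w) ul′
        (All.zipWith (λ (r , ne) → inRange-shrink˘ r ne) (All-remove {InRange a (suc d + a)} u rl , d+a∉))))

unique-inRange⇒length+a≤ : ∀ {a b} l → a ≤ b → Unique l → All (InRange a b) l → length l + a ≤ b
unique-inRange⇒length+a≤ {a} {b} l a≤b ul rl = subst (length l + a ≤_) (m∸n+n≡m a≤b)
  (+-monoˡ-≤ a (unique-inRange⇒length≤ a (b ∸ a) l ul
    (All.map (λ (a≤x , x<b) → a≤x , subst (_ <_) (sym (m∸n+n≡m a≤b)) x<b) rl)))

-- 132-avoidance of lists

No32Above : ℕ → List ℕ → Set
No32Above x = AllPairs (λ y z → ¬ (x < z × z < y))

Avoids132ˡ : List ℕ → Set
Avoids132ˡ [] = ⊤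
Avoids132ˡ (x ∷ l) = No32Above x l × Avoids132ˡ l

avoids-++⁻ˡ : ∀ u {v} → Avoids132ˡ (u ++ v) → Avoids132ˡ u
avoids-++⁻ˡ [] _ = tt
avoids-++⁻ˡ (x ∷ u) (nx , av) = proj₁ (AllPairs-++⁻ u nx) , avoids-++⁻ˡ u av

avoids-++⁻ʳ : ∀ u {v} → Avoids132ˡ (u ++ v) → Avoids132ˡ v
avoids-++⁻ʳ [] av = av
avoids-++⁻ʳ (x ∷ u) (_ , av) = avoids-++⁻ʳ u av

-- x … M … y with x < y < M would be a 132 pattern.
avoids-before-max : ∀ α {M β} → Avoids132ˡ (α ++ M ∷ β) → All (_< M) β →
  All (λ x → All (λ y → ¬ x < y) β) α
avoids-before-max [] _ _ = []
avoids-before-max (x ∷ α) (nx , av) y<M with AllPairs-++⁻ α nx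
... | _ , M∷β ∷ _ , _ =
  All.zipWith (λ (no32 , y<M) x<y → no32 (x<y , y<M)) (M∷β , y<M) ∷ avoids-before-max α av y<M

-- An entry can be appended unless it would play the role of the 2.
avoids-∷ʳ : ∀ u z → Avoids132ˡ u → All (λ x → ¬ x < z) u ⊎ All (_< z) u → Avoids132ˡ (u ∷ʳ z)
avoids-∷ʳ [] z _ _ = [] , tt
avoids-∷ʳ (x ∷ u) z (nx , av) side =
  AllPairs.++⁺ nx ([] ∷ []) (All.tabulate (λ {y} y∈u → noPattern side y∈u ∷ [])) ,
  avoids-∷ʳ u z av (Data.Sum.map All.tail All.tail side)
  where
  noPattern : ∀ {y} → All (λ x → ¬ x < z) (x ∷ u) ⊎ All (_< z) (x ∷ u) → y ∈ u → ¬ (x < z × z < y)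
  noPattern (inj₁ (x≮z ∷ _)) _ (x<z , _) = x≮z x<z
  noPattern (inj₂ (_ ∷ u<z)) y∈u (_ , z<y) = <-asym z<y (All.lookup u<z y∈u)

avoids-max-∷ : ∀ {M} u → All (_< M) u → Avoids132ˡ u → Avoids132ˡ (M ∷ u)
avoids-max-∷ {M} u u<M av = no32 u u<M , av
  where
  no32 : ∀ u → All (_< M) u → No32Above M u
  no32 [] _ = []
  no32 (y ∷ u) (_ ∷ u<M) = All.map (λ z<M (M<z , _) → <-asym M<z z<M) u<M ∷ no32 u u<M

avoids-map-suc⁺ : ∀ u → Avoids132ˡ u → Avoids132ˡ (map suc u)
avoids-map-suc⁺ [] _ = tt
avoids-map-suc⁺ (x ∷ u) (nx , av) =
  AllPairs.map⁺ (AllPairs.map (λ no32 (x<z , z<y) → no32 (≤-pred x<z , ≤-pred z<y)) nx) ,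
  avoids-map-suc⁺ u av

avoids-map-suc⁻ : ∀ u → Avoids132ˡ (map suc u) → Avoids132ˡ u
avoids-map-suc⁻ [] _ = tt
avoids-map-suc⁻ (x ∷ u) (nx , av) =
  AllPairs.map (λ no32 (x<z , z<y) → no32 (s≤s x<z , s≤s z<y)) (AllPairs.map⁻ nx) ,
  avoids-map-suc⁻ u av

-- Permutations of intervals

IsPermFrom : ℕ → List ℕ → Set
IsPermFrom a l = Unique l × All (InRange a (length l + a)) l

length-++-∷ : ∀ u (y : ℕ) w → length (u ++ y ∷ w) ≡ suc (length u + length w)
length-++-∷ u y w = trans (length-remove u y w) (cong suc (length-++ u))

max∈ : ∀ a x l → IsPermFrom a (x ∷ l) →
  ∃ λ u → ∃ λ w → x ∷ l ≡ u ++ length u + (length w + a) ∷ w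
max∈ a x l (ul , rl) with length l + a ∈? x ∷ l
... | no max∉ = ⊥-elim (1+n≰n (unique-inRange⇒length≤ a (length l) (x ∷ l) ul
        (All.zipWith (λ (r , ne) → inRange-shrink˘ r ne) (rl , ¬Any⇒All¬ (x ∷ l) max∉))))
... | yes max∈l with ∈-∃++ max∈l
...   | u , w , eq = u , w , subst (λ m → x ∷ l ≡ u ++ m ∷ w) max≡ eq
  where
  max≡ : length l + a ≡ length u + (length w + a)
  max≡ = trans (cong (_+ a) (suc-injective (trans (cong length eq) (length-++-∷ u _ w))))
               (+-assoc (length u) _ _)

data MaxSplit (a : ℕ) : List ℕ → Set where
  split : ∀ α β → IsPermFrom (length β + a) α → IsPermFrom a β → Avoids132ˡ α → Avoids132ˡ β →
          MaxSplit a (α ++ length α + (length β + a) ∷ β)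

-- In a 132-avoider α M β the entries of α exceed those of β, so by pigeonhole
-- β fills the bottom and α the top of the interval.
maxSplit-intervals : ∀ a α β → let M = length α + (length β + a) in
  IsPermFrom a (α ++ M ∷ β) → Avoids132ˡ (α ++ M ∷ β) →
  IsPermFrom (length β + a) α × IsPermFrom a β
maxSplit-intervals a α β (ul , rl) av =
  (uα , All.zipWith (λ (r , β<x , x≢) → α-range r β<x (All.head x≢)) (rα , All.zip (β<α , α≢))) ,
  (uβ , All.zipWith (λ (r , y<M , y<α) → β-range r y<M y<α) (rβ , All.zip (β<M , All.All-swap β<α)))
  where
  M : ℕ
  M = length α + (length β + a)
  len-l : length (α ++ M ∷ β) + a ≡ suc M
  len-l = trans (cong (_+ a) (length-++-∷ α M β)) (cong suc (+-assoc (length α) _ _))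
  uα : Unique α
  uα = proj₁ (AllPairs-++⁻ α ul)
  uMβ : Unique (M ∷ β)
  uMβ = proj₁ (proj₂ (AllPairs-++⁻ α ul))
  uβ : Unique β
  uβ = AllPairs.tail uMβ
  α≢ : All (λ x → All (x ≢_) (M ∷ β)) α
  α≢ = proj₂ (proj₂ (AllPairs-++⁻ α ul))
  rα : All (InRange a (suc M)) α
  rα = All.++⁻ˡ α (subst (λ b → All (InRange a b) (α ++ M ∷ β)) len-l rl)
  rβ : All (InRange a (suc M)) β
  rβ = All.tail (All.++⁻ʳ α (subst (λ b → All (InRange a b) (α ++ M ∷ β)) len-l rl))
  β<M : All (_< M) β
  β<M = All.zipWith (λ (r , ne) → proj₂ (inRange-shrink˘ r ne)) (rβ , AllPairs.head uMβ)
  β<α : All (λ x → All (_< x) β) α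
  β<α = All.zipWith
    (λ (x≮β , x≢) →
      All.zipWith (λ (x≮y , x≢y) → ≤∧≢⇒< (≮⇒≥ x≮y) (≢-sym x≢y)) (x≮β , All.tail x≢))
    (avoids-before-max α av β<M , α≢)
  α-range : ∀ {x} → InRange a (suc M) x → All (_< x) β → x ≢ M →
    InRange (length β + a) (length α + (length β + a)) x
  α-range {x} r@(a≤x , _) β<x x≢M =
    unique-inRange⇒length+a≤ β a≤x uβ (All.zipWith (λ ((a≤y , _) , y<x) → a≤y , y<x) (rβ , β<x)) ,
    proj₂ (inRange-shrink r x≢M)
  β-range : ∀ {y} → InRange a (suc M) y → y < M → All (y <_) α → InRange a (length β + a) y
  β-range {y} (a≤y , _) y<M y<α = a≤y , +-cancelˡ-≤ (length α) _ _ (begin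
    length α + suc y       ≤⟨ ≤-pred (unique-inRange⇒length+a≤ (M ∷ α) (s≤s (<⇒≤ y<M)) uMα
                                ((y<M , ≤-refl) ∷
                                 All.zipWith (λ (y<x , (_ , x<M+1)) → y<x , x<M+1) (y<α , rα))) ⟩
    length α + (length β + a) ∎)
    where
    open ≤-Reasoning
    uMα : Unique (M ∷ α)
    uMα = All.map (≢-sym ∘ All.head) α≢ ∷ uα

decompose : ∀ a l → 0 < length l → IsPermFrom a l → Avoids132ˡ l → MaxSplit a l
decompose a (x ∷ l) _ ip av =
  let α , β , eq = max∈ a x l ip
      ip′ = subst (IsPermFrom a) eq ip
      av′ = subst Avoids132ˡ eq av
      ipα , ipβ = maxSplit-intervals a α β ip′ av′
  in subst (MaxSplit a) (sym eq) (split α β ipα ipβ (avoids-++⁻ˡ α av′) (proj₂ (avoids-++⁻ʳ α av′)))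

singleton-perm : ∀ {a x} → IsPermFrom a (x ∷ []) → x ≡ a
singleton-perm (_ , (a≤x , x<1+a) ∷ []) = ≤-antisym (≤-pred x<1+a) a≤x

2≤#adj-acc : ∀ a l → Acc _<_ (length l) → 2 ≤ length l → IsPermFrom a l → Avoids132ˡ l → 2 ≤ #adj l
2≤#adj-acc a l (acc rec) 2≤len ip av with decompose a l (<-≤-trans (s≤s z≤n) 2≤len) ip av
... | split [] [] _ _ _ _ = ⊥-elim (1+n≰n (≤-pred 2≤len))
... | split [] (y ∷ []) _ ipβ _ _ rewrite singleton-perm ipβ = ≤-reflexive (sym (#adj-pair˘ a))
... | split [] β@(_ ∷ _ ∷ _) _ ipβ _ avβ =
  #adj-++ {u = [ length β + a ]} {v = β} {m = 0} z≤n (2≤#adj-acc a β (rec ≤-refl) (s≤s (s≤s z≤n)) ipβ avβ)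
... | split (x ∷ []) β ipα _ _ _ rewrite singleton-perm ipα = 2≤#adj-∷-suc (length β + a) β
... | split α@(_ ∷ _ ∷ _) β ipα _ avα _ =
  #adj-++ {u = α} {v = length α + (length β + a) ∷ β} {n = 0}
    (2≤#adj-acc (length β + a) α (rec α<l) (s≤s (s≤s z≤n)) ipα avα) z≤n
  where
  α<l : length α < length (α ++ length α + (length β + a) ∷ β)
  α<l = subst (length α <_) (sym (length-++-∷ α _ β)) (s≤s (m≤m+n _ _))

2≤#adj : ∀ a l → 2 ≤ length l → IsPermFrom a l → Avoids132ˡ l → 2 ≤ #adj l
2≤#adj a l = 2≤#adj-acc a l (<-wellFounded (length l))

length-∷ʳ : ∀ u (x : ℕ) → length (u ∷ʳ x) ≡ suc (length u)
length-∷ʳ [] x = refl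
length-∷ʳ (y ∷ u) x = cong suc (length-∷ʳ u x)

init-last : ∀ x u → ∃ λ v → x ∷ u ≡ v ∷ʳ last⁺ x u
init-last x [] = [] , refl
init-last x (y ∷ u) = let v , eq = init-last y u in x ∷ v , cong (x ∷_) eq

last⁺-∈ : ∀ {P : ℕ → Set} x u → All P (x ∷ u) → P (last⁺ x u)
last⁺-∈ x [] (p ∷ _) = p
last⁺-∈ x (y ∷ u) (_ ∷ ps) = last⁺-∈ y u ps

perm-max-∷ : ∀ a u → IsPermFrom a u → IsPermFrom a (length u + a ∷ u)
perm-max-∷ a u (uu , ru) =
  All.map (λ (_ , x<M) M≡x → <-irrefl (sym M≡x) x<M) ru ∷ uu ,
  (m≤n+m a (length u) , ≤-refl) ∷ All.map (λ (a≤x , x<M) → a≤x , m<n⇒m<1+n x<M) ru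

perm-∷ʳ-max : ∀ a u → IsPermFrom a u → IsPermFrom a (u ∷ʳ (length u + a))
perm-∷ʳ-max a u (uu , ru) =
  AllPairs.++⁺ uu ([] ∷ []) (All.map (λ (_ , x<M) → (λ x≡M → <-irrefl x≡M x<M) ∷ []) ru) ,
  subst (λ b → All (InRange a b) (u ∷ʳ M)) (sym len)
    (All.++⁺ (All.map (λ (a≤x , x<M) → a≤x , m<n⇒m<1+n x<M) ru) ((m≤n+m a (length u) , ≤-refl) ∷ []))
  where
  M : ℕ
  M = length u + a
  len : length (u ∷ʳ M) + a ≡ suc M
  len = cong (_+ a) (length-∷ʳ u M)

perm-∷ʳ-min : ∀ a u → IsPermFrom (suc a) u → IsPermFrom a (u ∷ʳ a)
perm-∷ʳ-min a u (uu , ru) =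
  AllPairs.++⁺ uu ([] ∷ []) (All.map (λ (a<x , _) → (λ x≡a → <-irrefl (sym x≡a) a<x) ∷ []) ru) ,
  subst (λ b → All (InRange a b) (u ∷ʳ a)) (sym len)
    (All.++⁺ (All.map (λ {x} (a<x , x<) → <⇒≤ a<x , subst (x <_) (+-suc (length u) a) x<) ru)
             ((≤-refl , s≤s (m≤n+m a (length u))) ∷ []))
  where
  len : length (u ∷ʳ a) + a ≡ suc (length u + a)
  len = cong (_+ a) (length-∷ʳ u a)

perm-drop-max-∷ : ∀ a x u → IsPermFrom a (x ∷ u) → x ≡ length u + a → IsPermFrom a u
perm-drop-max-∷ a x u (x∉u ∷ uu , _ ∷ ru) x≡M =
  uu , All.zipWith (λ (r , x≢y) → inRange-shrink˘ r (λ M≡y → x≢y (trans x≡M M≡y))) (ru , x∉u)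

perm-drop-max-∷ʳ : ∀ a u x → IsPermFrom a (u ∷ʳ x) → x ≡ length u + a → IsPermFrom a u
perm-drop-max-∷ʳ a u x (uu , ru) x≡M =
  let uu′ , _ , u≢x = AllPairs-++⁻ u uu
      ru′ = All.++⁻ˡ u (subst (λ b → All (InRange a b) (u ∷ʳ x)) len ru)
  in uu′ , All.zipWith (λ (r , y≢x) → inRange-shrink r (λ y≡M → All.head y≢x (trans y≡M (sym x≡M))))
                       (ru′ , u≢x)
  where
  len : length (u ∷ʳ x) + a ≡ suc (length u + a)
  len = cong (_+ a) (length-∷ʳ u x)

perm-map-suc : ∀ a u → IsPermFrom a u → IsPermFrom (suc a) (map suc u)
perm-map-suc a u (uu , ru) =
  AllPairs.map⁺ (AllPairs.map (λ x≢y → x≢y ∘ suc-injective) uu) ,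
  subst (λ b → All (InRange (suc a) b) (map suc u)) (sym len)
    (All.map⁺ (All.map (λ (a≤x , x<) → s≤s a≤x , s≤s x<) ru))
  where
  len : length (map suc u) + suc a ≡ suc (length u + a)
  len = trans (cong (_+ suc a) (length-map suc u)) (+-suc (length u) a)

perm-map-suc⁻ : ∀ a u → IsPermFrom (suc a) (map suc u) → IsPermFrom a u
perm-map-suc⁻ a u (uu , ru) =
  AllPairs.map (λ sx≢sy → sx≢sy ∘ cong suc) (AllPairs.map⁻ uu) ,
  All.map (λ {x} (sa≤sx , sx<) → ≤-pred sa≤sx , ≤-pred (subst (suc x <_) len sx<)) (All.map⁻ ru)
  where
  len : length (map suc u) + suc a ≡ suc (length u + a)
  len = trans (cong (_+ suc a) (length-map suc u)) (+-suc (length u) a)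

map-suc-pred : ∀ u → All (1 ≤_) u → map suc (map pred u) ≡ u
map-suc-pred [] _ = refl
map-suc-pred (suc x ∷ u) (_ ∷ 1≤u) = cong (suc x ∷_) (map-suc-pred u 1≤u)

perm-pred : ∀ a u → IsPermFrom (suc a) u → ∃ λ u₀ → u ≡ map suc u₀ × IsPermFrom a u₀
perm-pred a u ip = map pred u , sym u≡ , perm-map-suc⁻ a (map pred u) (subst (IsPermFrom (suc a)) (sym u≡) ip)
  where
  u≡ : map suc (map pred u) ≡ u
  u≡ = map-suc-pred u (All.map (λ (a<x , _) → ≤-trans (s≤s z≤n) a<x) (proj₂ ip))

perm-bound : ∀ {l m} → IsPermFrom 1 l → length l ≡ m → All (λ x → 1 ≤ x × x ≤ m) l
perm-bound {l} (_ , rl) refl =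
  All.map (λ {x} (1≤x , x<) → 1≤x , ≤-pred (subst (x <_) (+-comm (length l) 1) x<)) rl

-- Shapes of admissible permutations

Admissible : List ℕ → Set
Admissible l = IsPermFrom 1 l × Avoids132ˡ l × #adj l ≡ 3

HeadIsNot : ℕ → List ℕ → Set
HeadIsNot n [] = ⊤
HeadIsNot n (x ∷ _) = x ≢ n

LastIsNot : ℕ → List ℕ → Set
LastIsNot n [] = ⊤
LastIsNot n (x ∷ l) = last⁺ x l ≢ n

-- The admissible lists of length j + 2, sorted by the neighbours of the maximum j + 2.
data Shape (j : ℕ) : List ℕ → Set where
  max-first    : ∀ {β} → Admissible β → HeadIsNot (suc j) β → Shape j (suc (suc j) ∷ β)
  max-last     : ∀ {α} → Admissible α → LastIsNot (suc j) α → Shape j (α ∷ʳ suc (suc j))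
  max-before-1 : ∀ {α} → Admissible α → LastIsNot j α → Shape j (map suc α ∷ʳ suc (suc j) ∷ʳ 1)

#adj-++≢3 : ∀ u v → 2 ≤ #adj u → 2 ≤ #adj v → #adj (u ++ v) ≢ 3
#adj-++≢3 u v 2≤u 2≤v = ≢-sym (<⇒≢ (#adj-++ {u} {v} 2≤u 2≤v))

-- The pair t, t + 1 gives two adjacency indices besides the two of the permutation
-- that is left when t is removed.
last-then-suc : ∀ a x α w {t} → 2 ≤ length α → IsPermFrom a (x ∷ α) → Avoids132ˡ (x ∷ α) →
  t ≡ length α + a → last⁺ x α ≡ t → #adj (x ∷ α ++ suc t ∷ w) ≢ 3
last-then-suc a x α w {t} 2≤len ip av t≡ last≡ =
  let v , x∷α≡ = init-last x α
      x∷α≡v∷ʳt = trans x∷α≡ (cong (v ∷ʳ_) last≡)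
      len-v = suc-injective (trans (sym (length-∷ʳ v t)) (sym (cong length x∷α≡v∷ʳt)))
      ipv = perm-drop-max-∷ʳ a v t (subst (IsPermFrom a) x∷α≡v∷ʳt ip) (trans t≡ (cong (_+ a) (sym len-v)))
      avv = avoids-++⁻ˡ v (subst Avoids132ˡ x∷α≡v∷ʳt av)
      l≡ = trans (cong (_++ suc t ∷ w) x∷α≡v∷ʳt) (∷ʳ-++ v t (suc t ∷ w))
  in subst (λ l → #adj l ≢ 3) (sym l≡)
       (#adj-++≢3 v (t ∷ suc t ∷ w)
         (2≤#adj a v (subst (2 ≤_) (sym len-v) 2≤len) ipv avv) (2≤#adj-∷-suc t w))

shape-max-first : ∀ j → 3 ≤ j → ∀ y β → length β ≡ j →
  IsPermFrom 1 (y ∷ β) → Avoids132ˡ (y ∷ β) →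
  #adj (suc (suc j) ∷ y ∷ β) ≡ 3 → Shape j (suc (suc j) ∷ y ∷ β)
shape-max-first _ 3≤j y β refl ip av #3 with y ≟ suc (length β)
... | yes refl = ⊥-elim (#adj-++≢3 (suc y ∷ y ∷ []) β (≤-reflexive (sym (#adj-pair˘ y)))
        (2≤#adj 1 β (≤-trans (s≤s (s≤s z≤n)) 3≤j)
          (perm-drop-max-∷ 1 y β ip (+-comm 1 (length β))) (proj₂ av))
        #3)
... | no y≢ = max-first (ip , av , trans (sym (adjCount-join false (suc (suc (length β))) [] y β ¬adj)) #3) y≢
  where
  ¬adj : adjacent (suc (suc (length β))) y ≡ false
  ¬adj = ¬adjacent-top˘ (proj₂ (All.head (perm-bound ip refl))) y≢

shape-max-last : ∀ j → 3 ≤ j → ∀ x α → length α ≡ j →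
  IsPermFrom 1 (x ∷ α) → Avoids132ˡ (x ∷ α) →
  #adj (x ∷ α ∷ʳ suc (suc j)) ≡ 3 → Shape j (x ∷ α ∷ʳ suc (suc j))
shape-max-last _ 3≤j x α refl ip av #3 with last⁺ x α ≟ suc (length α)
... | yes last≡ = ⊥-elim (last-then-suc 1 x α [] (≤-trans (s≤s (s≤s z≤n)) 3≤j) ip av (+-comm 1 _) last≡ #3)
... | no last≢ =
  max-last (ip , av , trans (sym (+-identityʳ _)) (trans (sym (adjCount-join false x α _ [] ¬adj)) #3)) last≢
  where
  ¬adj : adjacent (last⁺ x α) (suc (suc (length α))) ≡ false
  ¬adj = ¬adjacent-top (last⁺-∈ x α (All.map proj₂ (perm-bound ip refl))) last≢

shape-max-before-1 : ∀ j → 3 ≤ j → ∀ x α → suc (length α) ≡ j → IsPermFrom 2 (x ∷ α) →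
  Avoids132ˡ (x ∷ α) → #adj (x ∷ α ++ suc (suc j) ∷ 1 ∷ []) ≡ 3 →
  Shape j (x ∷ α ++ suc (suc j) ∷ 1 ∷ [])
shape-max-before-1 _ 3≤j x α refl ip av #3 with last⁺ x α ≟ suc (suc (length α))
... | yes last≡ = ⊥-elim (last-then-suc 2 x α (1 ∷ []) (≤-pred 3≤j) ip av (+-comm 2 _) last≡ #3)
... | no last≢ with perm-pred 1 (x ∷ α) ip
...   | x₀ ∷ α₀ , refl , ip₀ =
  subst (Shape _) (∷ʳ-++ (map suc (x₀ ∷ α₀)) _ _)
    (max-before-1 (ip₀ , avoids-map-suc⁻ (x₀ ∷ α₀) av , #3′) (last≢ ∘ last≡))
  where
  j : ℕ
  j = suc (length (map suc α₀))
  last≡ : last⁺ x₀ α₀ ≡ j → last⁺ (suc x₀) (map suc α₀) ≡ suc j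
  last≡ eq = trans (last⁺-map-suc x₀ α₀) (cong suc eq)
  last₀≤ : last⁺ x₀ α₀ ≤ j
  last₀≤ = subst (last⁺ x₀ α₀ ≤_) (cong suc (sym (length-map suc α₀)))
    (last⁺-∈ x₀ α₀ (All.map proj₂ (perm-bound ip₀ refl)))
  ¬adj : adjacent (last⁺ (suc x₀) (map suc α₀)) (suc (suc j)) ≡ false
  ¬adj = subst (λ z → adjacent z (suc (suc j)) ≡ false) (sym (last⁺-map-suc x₀ α₀))
    (¬adjacent-top (s≤s last₀≤) (last≢ ∘ last≡ ∘ suc-injective))
  #3′ : #adj (x₀ ∷ α₀) ≡ 3
  #3′ = begin
    #adj (x₀ ∷ α₀)                                          ≡⟨ adjCount-map-suc false (x₀ ∷ α₀) ⟨
    #adj (map suc (x₀ ∷ α₀))                                ≡⟨ +-identityʳ _ ⟨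
    #adj (map suc (x₀ ∷ α₀)) + 0
      ≡⟨ cong (#adj (map suc (x₀ ∷ α₀)) +_) (#adj-top-1 (length (map Nat.suc α₀))) ⟨
    #adj (map suc (x₀ ∷ α₀)) + #adj (suc (suc j) ∷ 1 ∷ [])
      ≡⟨ adjCount-join false (suc x₀) (map suc α₀) _ _ ¬adj ⟨
    #adj (map suc (x₀ ∷ α₀) ++ suc (suc j) ∷ 1 ∷ [])        ≡⟨ #3 ⟩
    3                                                       ∎
    where open ≡-Reasoning

maximum≡ : ∀ a {b j} → a + b ≡ suc j → a + (b + 1) ≡ suc (suc j)
maximum≡ a {b} {j} a+b≡ = trans (sym (+-assoc a b 1)) (trans (cong (_+ 1) a+b≡) (+-comm (suc j) 1))

-- When α is nonempty and β has two entries, α M and β carry two adjacency indices each.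
classify-split : ∀ j → 3 ≤ j → ∀ α β → length α + length β ≡ suc j →
  IsPermFrom (length β + 1) α → IsPermFrom 1 β → Avoids132ˡ α → Avoids132ˡ β →
  #adj (α ++ suc (suc j) ∷ β) ≡ 3 → Shape j (α ++ suc (suc j) ∷ β)
classify-split j _ [] [] () _ _ _ _ _
classify-split j 3≤j [] (y ∷ β) len _ ipβ _ avβ #3 =
  shape-max-first j 3≤j y β (suc-injective len) ipβ avβ #3
classify-split j 3≤j (x ∷ α) [] len ipα _ avα _ #3 =
  shape-max-last j 3≤j x α (suc-injective (trans (sym (+-identityʳ _)) len)) ipα avα #3
classify-split j 3≤j (x ∷ α) (y ∷ []) len ipα ipβ avα _ #3 rewrite singleton-perm ipβ =
  shape-max-before-1 j 3≤j x α (trans (+-comm 1 (length α)) (suc-injective len)) ipα avα #3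
classify-split j 3≤j α@(_ ∷ _) β@(_ ∷ _ ∷ _) len ipα ipβ avα avβ #3 =
  ⊥-elim (#adj-++≢3 (α ∷ʳ M) β
    (2≤#adj (length β + 1) (α ∷ʳ M) (subst (2 ≤_) (sym (length-∷ʳ α M)) (s≤s (s≤s z≤n))) ipαM
      (avoids-∷ʳ α M avα (inj₂ α<M)))
    (2≤#adj 1 β (s≤s (s≤s z≤n)) ipβ avβ)
    (subst (λ l → #adj l ≡ 3) (sym (∷ʳ-++ α M β)) #3))
  where
  M : ℕ
  M = suc (suc j)
  M≡ : length α + (length β + 1) ≡ M
  M≡ = maximum≡ (length α) len
  α<M : All (_< M) α
  α<M = All.map proj₂ (subst (λ b → All (InRange (length β + 1) b) α) M≡ (proj₂ ipα))
  ipαM : IsPermFrom (length β + 1) (α ∷ʳ M)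
  ipαM = subst (λ m → IsPermFrom (length β + 1) (α ∷ʳ m)) M≡ (perm-∷ʳ-max (length β + 1) α ipα)

classify : ∀ j → 3 ≤ j → ∀ l → length l ≡ suc (suc j) → Admissible l → Shape j l
classify j 3≤j l len (ip , av , #3) with decompose 1 l (subst (0 <_) (sym len) (s≤s z≤n)) ip av
... | split α β ipα ipβ avα avβ =
  subst (λ M → Shape j (α ++ M ∷ β)) (sym M≡)
    (classify-split j 3≤j α β len′ ipα ipβ avα avβ (subst (λ M → #adj (α ++ M ∷ β) ≡ 3) M≡ #3))
  where
  len′ : length α + length β ≡ suc j
  len′ = suc-injective (trans (sym (length-++-∷ α _ β)) len)
  M≡ : length α + (length β + 1) ≡ suc (suc j)
  M≡ = maximum≡ (length α) len′

admissible-max-first : ∀ j β → length β ≡ suc j → Admissible β → HeadIsNot (suc j) β →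
  Admissible (suc (suc j) ∷ β) × LastIsNot (suc (suc j)) (suc (suc j) ∷ β)
admissible-max-first j (y ∷ β) len (ip , av , #3) y≢ =
  (subst (λ M → IsPermFrom 1 (M ∷ y ∷ β)) M≡ (perm-max-∷ 1 (y ∷ β) ip) ,
   avoids-max-∷ (y ∷ β) <M av ,
   trans (adjCount-join false (suc (suc j)) [] y β ¬adj) #3) ,
  λ last≡ → <-irrefl last≡ (last⁺-∈ y β <M)
  where
  ≤j+1 : All (_≤ suc j) (y ∷ β)
  ≤j+1 = All.map proj₂ (perm-bound ip len)
  <M : All (_< suc (suc j)) (y ∷ β)
  <M = All.map s≤s ≤j+1
  M≡ : length (y ∷ β) + 1 ≡ suc (suc j)
  M≡ = trans (+-comm (length (y ∷ β)) 1) (cong suc len)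
  ¬adj : adjacent (suc (suc j)) y ≡ false
  ¬adj = ¬adjacent-top˘ (All.head ≤j+1) y≢

admissible-max-last : ∀ j α → length α ≡ suc j → Admissible α → LastIsNot (suc j) α →
  Admissible (α ∷ʳ suc (suc j)) × HeadIsNot (suc (suc j)) (α ∷ʳ suc (suc j))
admissible-max-last j (x ∷ α) len (ip , av , #3) last≢ =
  (subst (λ M → IsPermFrom 1 (x ∷ α ∷ʳ M)) M≡ (perm-∷ʳ-max 1 (x ∷ α) ip) ,
   avoids-∷ʳ (x ∷ α) (suc (suc j)) av (inj₂ <M) ,
   trans (adjCount-join false x α (suc (suc j)) [] ¬adj) (trans (+-identityʳ _) #3)) ,
  λ x≡ → <-irrefl x≡ (All.head <M)
  where
  ≤j+1 : All (_≤ suc j) (x ∷ α)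
  ≤j+1 = All.map proj₂ (perm-bound ip len)
  <M : All (_< suc (suc j)) (x ∷ α)
  <M = All.map s≤s ≤j+1
  M≡ : length (x ∷ α) + 1 ≡ suc (suc j)
  M≡ = trans (+-comm (length (x ∷ α)) 1) (cong suc len)
  ¬adj : adjacent (last⁺ x α) (suc (suc j)) ≡ false
  ¬adj = ¬adjacent-top (last⁺-∈ x α ≤j+1) last≢

admissible-max-before-1 : ∀ j α → length α ≡ j → Admissible α → LastIsNot j α →
  let l = map suc α ∷ʳ suc (suc j) ∷ʳ 1 in
  Admissible l × HeadIsNot (suc (suc j)) l × LastIsNot (suc (suc j)) l
admissible-max-before-1 j [] len (_ , _ , ())
admissible-max-before-1 _ (x ∷ α) refl (ip , av , #3) last≢ =
  (perm-∷ʳ-min 1 (u ∷ʳ M)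
     (subst (λ m → IsPermFrom 2 (u ∷ʳ m)) M≡ (perm-∷ʳ-max 2 u (perm-map-suc 1 (x ∷ α) ip))) ,
   avoids-∷ʳ (u ∷ʳ M) 1 (avoids-∷ʳ u M (avoids-map-suc⁺ (x ∷ α) av) (inj₂ u<M))
     (inj₁ (All.++⁺ (All.map⁺ (All.universal (λ _ → λ { (s≤s ()) }) (x ∷ α)))
                    ((λ { (s≤s ()) }) ∷ []))) ,
   #3′) ,
  (λ sx≡M → <-irrefl sx≡M (All.head u<M)) ,
  (λ 1≡M → 1+n≢0 (suc-injective (trans (sym 1≡M) (last⁺-∷ʳ (suc x) (map suc α ∷ʳ M) 1))))
  where
  j M : ℕ
  j = length (x ∷ α)
  M = suc (suc j)
  u : List ℕ
  u = map suc (x ∷ α)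
  ≤j : All (_≤ j) (x ∷ α)
  ≤j = All.map proj₂ (perm-bound ip refl)
  u<M : All (_< M) u
  u<M = All.map⁺ (All.map (s≤s ∘ s≤s) ≤j)
  M≡ : length u + 2 ≡ M
  M≡ = trans (cong (_+ 2) (length-map suc (x ∷ α))) (+-comm j 2)
  ¬adj-u-M : adjacent (last⁺ (suc x) (map suc α)) M ≡ false
  ¬adj-u-M rewrite last⁺-map-suc x α = ¬adjacent-top (s≤s (last⁺-∈ x α ≤j)) (last≢ ∘ suc-injective)
  ¬adj-M-1 : adjacent (last⁺ (suc x) (map suc α ∷ʳ M)) 1 ≡ false
  ¬adj-M-1 rewrite last⁺-∷ʳ (suc x) (map suc α) M = ¬adjacent-> M 1 (s≤s (s≤s (s≤s z≤n)))
  #3′ : #adj (u ∷ʳ M ∷ʳ 1) ≡ 3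
  #3′ = begin
    #adj (u ∷ʳ M ∷ʳ 1)     ≡⟨ adjCount-join false (suc x) (map suc α ∷ʳ M) 1 [] ¬adj-M-1 ⟩
    #adj (u ∷ʳ M) + 0      ≡⟨ +-identityʳ _ ⟩
    #adj (u ∷ʳ M)          ≡⟨ adjCount-join false (suc x) (map suc α) M [] ¬adj-u-M ⟩
    #adj u + 0             ≡⟨ +-identityʳ _ ⟩
    #adj u                 ≡⟨ adjCount-map-suc false (x ∷ α) ⟩
    #adj (x ∷ α)           ≡⟨ #3 ⟩
    3                      ∎
    where open ≡-Reasoning

-- From vectors to lists

lookup⇒All : ∀ {P : ℕ → Set} {n} (σ : Vec ℕ n) → (∀ i → P (lookup σ i)) → All P (toList σ)
lookup⇒All σ = VecAll.toList⁺ ∘ VecAll.lookup⁻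

All⇒lookup : ∀ {P : ℕ → Set} {n} (σ : Vec ℕ n) → All P (toList σ) → ∀ i → P (lookup σ i)
All⇒lookup σ = VecAll.lookup⁺ ∘ VecAll.toList⁻

lookup-injective⇒unique : ∀ {n} (σ : Vec ℕ n) → (∀ i j → lookup σ i ≡ lookup σ j → i ≡ j) →
  Unique (toList σ)
lookup-injective⇒unique [] _ = []
lookup-injective⇒unique (x ∷ σ) inj =
  lookup⇒All σ (λ j x≡ → 0≢suc (inj zero (suc j) x≡)) ∷
  lookup-injective⇒unique σ (λ i j eq → Fin.suc-injective (inj (suc i) (suc j) eq))
  where
  0≢suc : ∀ {m} {j : Fin m} → zero ≢ suc j
  0≢suc ()

unique⇒lookup-injective : ∀ {n} (σ : Vec ℕ n) → Unique (toList σ) →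
  ∀ i j → lookup σ i ≡ lookup σ j → i ≡ j
unique⇒lookup-injective (x ∷ σ) _ zero zero _ = refl
unique⇒lookup-injective (x ∷ σ) (x∉σ ∷ _) zero (suc j) eq = ⊥-elim (All⇒lookup σ x∉σ j eq)
unique⇒lookup-injective (x ∷ σ) (x∉σ ∷ _) (suc i) zero eq = ⊥-elim (All⇒lookup σ x∉σ i (sym eq))
unique⇒lookup-injective (x ∷ σ) (_ ∷ uσ) (suc i) (suc j) eq = cong suc (unique⇒lookup-injective σ uσ i j eq)

isPerm⇒permFrom1 : ∀ {n} (σ : Vec ℕ n) → IsPerm σ → IsPermFrom 1 (toList σ)
isPerm⇒permFrom1 {n} σ (range , inj) =
  lookup-injective⇒unique σ inj ,
  lookup⇒All σ (λ i → proj₁ (range i) , subst (lookup σ i <_) n+1≡ (s≤s (proj₂ (range i))))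
  where
  n+1≡ : suc n ≡ length (toList σ) + 1
  n+1≡ = trans (+-comm 1 n) (cong (_+ 1) (sym (length-toList σ)))

permFrom1⇒isPerm : ∀ {n} (σ : Vec ℕ n) → IsPermFrom 1 (toList σ) → IsPerm σ
permFrom1⇒isPerm σ ip@(uσ , _) =
  All⇒lookup σ (perm-bound ip (length-toList σ)) , unique⇒lookup-injective σ uσ

no32⇒No32Above : ∀ {m} x (τ : Vec ℕ m) →
  (∀ (j k : Fin m) → toℕ j < toℕ k → ¬ (x < lookup τ k × lookup τ k < lookup τ j)) →
  No32Above x (toList τ)
no32⇒No32Above x [] _ = []
no32⇒No32Above x (y ∷ τ) no32 =
  lookup⇒All τ (λ k → no32 zero (suc k) (s≤s z≤n)) ∷
  no32⇒No32Above x τ (λ j k j<k → no32 (suc j) (suc k) (s≤s j<k))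

No32Above⇒no32 : ∀ {m} x (τ : Vec ℕ m) → No32Above x (toList τ) →
  ∀ (j k : Fin m) → toℕ j < toℕ k → ¬ (x < lookup τ k × lookup τ k < lookup τ j)
No32Above⇒no32 x (y ∷ τ) (y∼τ ∷ _) zero (suc k) _ = All⇒lookup τ y∼τ k
No32Above⇒no32 x (y ∷ τ) (_ ∷ no32) (suc j) (suc k) (s≤s j<k) = No32Above⇒no32 x τ no32 j k j<k

avoids132⇒avoids132ˡ : ∀ {n} (σ : Vec ℕ n) → Avoids132 σ → Avoids132ˡ (toList σ)
avoids132⇒avoids132ˡ [] _ = tt
avoids132⇒avoids132ˡ (x ∷ σ) av =
  no32⇒No32Above x σ (λ j k j<k → av zero (suc j) (suc k) (s≤s z≤n) (s≤s j<k)) ,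
  avoids132⇒avoids132ˡ σ (λ i j k i<j j<k → av (suc i) (suc j) (suc k) (s≤s i<j) (s≤s j<k))

avoids132ˡ⇒avoids132 : ∀ {n} (σ : Vec ℕ n) → Avoids132ˡ (toList σ) → Avoids132 σ
avoids132ˡ⇒avoids132 (x ∷ σ) (no32 , _) zero (suc j) (suc k) _ (s≤s j<k) = No32Above⇒no32 x σ no32 j k j<k
avoids132ˡ⇒avoids132 (x ∷ σ) (_ , av) (suc i) (suc j) (suc k) (s≤s i<j) (s≤s j<k) =
  avoids132ˡ⇒avoids132 σ av i j k i<j j<k

firstNotMax⇒headIsNot : ∀ {n} (σ : Vec ℕ n) → FirstNotMax σ → HeadIsNot n (toList σ)
firstNotMax⇒headIsNot [] _ = tt
firstNotMax⇒headIsNot (x ∷ σ) first≢ = first≢ zero refl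

headIsNot⇒firstNotMax : ∀ {n} (σ : Vec ℕ n) → HeadIsNot n (toList σ) → FirstNotMax σ
headIsNot⇒firstNotMax (x ∷ σ) x≢ zero _ = x≢

lastNot⇒lastIsNot : ∀ {m} c (σ : Vec ℕ m) → (∀ i → toℕ i ≡ m ∸ 1 → lookup σ i ≢ c) →
  LastIsNot c (toList σ)
lastNot⇒lastIsNot c [] _ = tt
lastNot⇒lastIsNot c (x ∷ []) last≢ = last≢ zero refl
lastNot⇒lastIsNot c (x ∷ y ∷ σ) last≢ =
  lastNot⇒lastIsNot c (y ∷ σ) (λ i eq → last≢ (suc i) (cong suc eq))

lastIsNot⇒lastNot : ∀ {m} c (σ : Vec ℕ m) → LastIsNot c (toList σ) →
  ∀ i → toℕ i ≡ m ∸ 1 → lookup σ i ≢ c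
lastIsNot⇒lastNot c (x ∷ []) last≢ zero _ = last≢
lastIsNot⇒lastNot c (x ∷ y ∷ σ) last≢ (suc i) eq = lastIsNot⇒lastNot c (y ∷ σ) last≢ i (suc-injective eq)

does-⇔ : ∀ {A B : Set} (a? : Dec A) (b? : Dec B) → A ⇔ B → does a? ≡ does b?
does-⇔ a? (yes b) a⇔b = dec-true a? (Equivalence.from a⇔b b)
does-⇔ a? (no ¬b) a⇔b = dec-false a? (¬b ∘ Equivalence.to a⇔b)

countᶠ : ∀ n → (Fin n → Bool) → ℕ
countᶠ zero _ = 0
countᶠ (suc n) f = bit (f zero) + countᶠ n (f ∘ suc)

countᶠ-cong : ∀ n {f g : Fin n → Bool} → (∀ i → f i ≡ g i) → countᶠ n f ≡ countᶠ n g
countᶠ-cong zero _ = refl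
countᶠ-cong (suc n) f≗g = cong₂ _+_ (cong bit (f≗g zero)) (countᶠ-cong n (f≗g ∘ suc))

length-filter-tabulate : ∀ {A : Set} {P : A → Set} (P? : Decidable P) n (g : Fin n → A) →
  length (filter P? (tabulate g)) ≡ countᶠ n (does ∘ P? ∘ g)
length-filter-tabulate P? zero g = refl
length-filter-tabulate P? (suc n) g with does (P? (g zero))
... | true = cong suc (length-filter-tabulate P? n (g ∘ suc))
... | false = length-filter-tabulate P? n (g ∘ suc)

isAdj : ∀ {m} → Vec ℕ m → Fin m → Bool
isAdj σ i = does (AdjIndex? σ i)

-- The flag of adjCount, moved onto the first index.
adjFlags : ∀ {m} → Bool → Vec ℕ m → Fin m → Bool
adjFlags b σ zero = b ∨ isAdj σ zero
adjFlags b σ (suc i) = isAdj σ (suc i)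

adjIndex-singleton : ∀ x → ¬ AdjIndex (x ∷ []) zero
adjIndex-singleton x (inj₁ (zero , () , _))
adjIndex-singleton x (inj₂ (zero , () , _))

adjIndex-zero : ∀ {m} x y (τ : Vec ℕ m) → AdjIndex (x ∷ y ∷ τ) zero ⇔ ∣ x - y ∣ ≡ 1
adjIndex-zero x y τ = mk⇔ to (λ d → inj₁ (suc zero , refl , d))
  where
  to : AdjIndex (x ∷ y ∷ τ) zero → ∣ x - y ∣ ≡ 1
  to (inj₁ (suc zero , _ , d)) = d
  to (inj₁ (suc (suc _) , () , _))
  to (inj₂ (_ , () , _))

adjIndex-one : ∀ {m} x y (τ : Vec ℕ m) →
  AdjIndex (x ∷ y ∷ τ) (suc zero) ⇔ (∣ x - y ∣ ≡ 1 ⊎ AdjIndex (y ∷ τ) zero)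
adjIndex-one x y τ = mk⇔ to from
  where
  to : AdjIndex (x ∷ y ∷ τ) (suc zero) → ∣ x - y ∣ ≡ 1 ⊎ AdjIndex (y ∷ τ) zero
  to (inj₁ (suc j , eq , d)) = inj₂ (inj₁ (j , suc-injective eq , d))
  to (inj₂ (zero , _ , d)) = inj₁ d
  from : ∣ x - y ∣ ≡ 1 ⊎ AdjIndex (y ∷ τ) zero → AdjIndex (x ∷ y ∷ τ) (suc zero)
  from (inj₁ d) = inj₂ (zero , refl , d)
  from (inj₂ (inj₁ (j , eq , d))) = inj₁ (suc j , cong suc eq , d)

adjIndex-suc-suc : ∀ {m} x y (τ : Vec ℕ m) i →
  AdjIndex (x ∷ y ∷ τ) (suc (suc i)) ⇔ AdjIndex (y ∷ τ) (suc i)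
adjIndex-suc-suc x y τ i = mk⇔ to from
  where
  to : AdjIndex (x ∷ y ∷ τ) (suc (suc i)) → AdjIndex (y ∷ τ) (suc i)
  to (inj₁ (suc j , eq , d)) = inj₁ (j , suc-injective eq , d)
  to (inj₂ (suc j , eq , d)) = inj₂ (j , suc-injective eq , d)
  from : AdjIndex (y ∷ τ) (suc i) → AdjIndex (x ∷ y ∷ τ) (suc (suc i))
  from (inj₁ (j , eq , d)) = inj₁ (suc j , cong suc eq , d)
  from (inj₂ (j , eq , d)) = inj₂ (suc j , cong suc eq , d)

adjFlags-∷ : ∀ {m} b x y (τ : Vec ℕ m) i →
  adjFlags b (x ∷ y ∷ τ) (suc i) ≡ adjFlags (adjacent x y) (y ∷ τ) i
adjFlags-∷ b x y τ zero =
  does-⇔ (AdjIndex? (x ∷ y ∷ τ) (suc zero)) ((∣ x - y ∣ ≟ 1) ⊎-dec AdjIndex? (y ∷ τ) zero)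
    (adjIndex-one x y τ)
adjFlags-∷ b x y τ (suc i) =
  does-⇔ (AdjIndex? (x ∷ y ∷ τ) (suc (suc i))) (AdjIndex? (y ∷ τ) (suc i)) (adjIndex-suc-suc x y τ i)

countᶠ-adjFlags : ∀ {m} b (σ : Vec ℕ m) → countᶠ m (adjFlags b σ) ≡ adjCount b (toList σ)
countᶠ-adjFlags b [] = refl
countᶠ-adjFlags b (x ∷ [])
  rewrite dec-false (AdjIndex? (x ∷ []) zero) (adjIndex-singleton x) | ∨-identityʳ b = +-identityʳ (bit b)
countᶠ-adjFlags b (x ∷ y ∷ τ) = cong₂ _+_
  (cong (λ c → bit (b ∨ c)) (does-⇔ (AdjIndex? (x ∷ y ∷ τ) zero) (∣ x - y ∣ ≟ 1) (adjIndex-zero x y τ)))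
  (trans (countᶠ-cong _ (adjFlags-∷ b x y τ)) (countᶠ-adjFlags (adjacent x y) (y ∷ τ)))

numAdj≡#adj : ∀ {n} (σ : Vec ℕ n) → numAdj σ ≡ #adj (toList σ)
numAdj≡#adj {n} σ = begin
  numAdj σ                  ≡⟨ length-filter-tabulate (AdjIndex? σ) n id ⟩
  countᶠ n (isAdj σ)        ≡⟨ countᶠ-cong n (λ { zero → refl ; (suc i) → refl }) ⟩
  countᶠ n (adjFlags false σ) ≡⟨ countᶠ-adjFlags false σ ⟩
  #adj (toList σ)           ∎
  where open ≡-Reasoning

good₁-dec : ∀ {n} (σ : Vec ℕ n) → Dec (IsPerm σ × Avoids132 σ × FirstNotMax σ × numAdj σ ≡ 3)
good₁-dec σ = IsPerm? σ ×-dec Avoids132? σ ×-dec FirstNotMax? σ ×-dec (numAdj σ ≟ 3)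

good₂-dec : ∀ {n} (σ : Vec ℕ n) → Dec (IsPerm σ × Avoids132 σ × LastNotMax σ × numAdj σ ≡ 3)
good₂-dec σ = IsPerm? σ ×-dec Avoids132? σ ×-dec LastNotMax? σ ×-dec (numAdj σ ≟ 3)

good₁⇒ : ∀ {n} (σ : Vec ℕ n) → Good₁ σ → Admissible (toList σ) × HeadIsNot n (toList σ)
good₁⇒ {n} σ g with toWitness {a? = good₁-dec σ} g
... | perm , av , first≢ , #3 =
  (isPerm⇒permFrom1 σ perm , avoids132⇒avoids132ˡ σ av , trans (sym (numAdj≡#adj σ)) #3) ,
  firstNotMax⇒headIsNot σ first≢

⇒good₁ : ∀ {n} (σ : Vec ℕ n) {l} → toList σ ≡ l → Admissible l → HeadIsNot n l → Good₁ σ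
⇒good₁ σ refl (ip , av , #3) head≢ = fromWitness
  (permFrom1⇒isPerm σ ip , avoids132ˡ⇒avoids132 σ av , headIsNot⇒firstNotMax σ head≢ ,
   trans (numAdj≡#adj σ) #3)

good₂⇒ : ∀ {n} (σ : Vec ℕ n) → Good₂ σ → Admissible (toList σ) × LastIsNot n (toList σ)
good₂⇒ {n} σ g with toWitness {a? = good₂-dec σ} g
... | perm , av , last≢ , #3 =
  (isPerm⇒permFrom1 σ perm , avoids132⇒avoids132ˡ σ av , trans (sym (numAdj≡#adj σ)) #3) ,
  lastNot⇒lastIsNot n σ last≢

⇒good₂ : ∀ {n} (σ : Vec ℕ n) {l} → toList σ ≡ l → Admissible l → LastIsNot n l → Good₂ σ
⇒good₂ {n} σ refl (ip , av , #3) last≢ = fromWitness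
  (permFrom1⇒isPerm σ ip , avoids132ˡ⇒avoids132 σ av , lastIsNot⇒lastNot n σ last≢ ,
   trans (numAdj≡#adj σ) #3)

-- The recursion

Good₁Perms Good₂Perms : ℕ → Set
Good₁Perms n = Σ (Vec ℕ n) Good₁
Good₂Perms n = Σ (Vec ℕ n) Good₂

Σ-≡-irrelevant : ∀ {A : Set} {Q : A → Set} → (∀ {x} (p q : Q x) → p ≡ q) →
  ∀ {x y} {p : Q x} {q : Q y} → x ≡ y → (x , p) ≡ (y , q)
Σ-≡-irrelevant irr {p = p} {q} refl = cong (_ ,_) (irr p q)

injective-surjective⇒↔ : ∀ {A B : Set} (f : A → B) → (∀ {x y} → f x ≡ f y → x ≡ y) →
  (∀ y → ∃ λ x → f x ≡ y) → A ↔ B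
injective-surjective⇒↔ f inj surj = ⤖⇒↔ (mk⤖ (inj , strictlySurjective⇒surjective surj))

↔-Fin-+ : ∀ {A B C : Set} {a b} → A ↔ (B ⊎ C) → B ↔ Fin a → C ↔ Fin b → A ↔ Fin (a + b)
↔-Fin-+ A↔B⊎C B↔a C↔b = ↔-trans A↔B⊎C (↔-trans (B↔a ⊎-↔ C↔b) (↔-sym (+↔⊎)))

toList-∷ʳ : ∀ {A : Set} {m} (xs : Vec A m) x → toList (xs ∷ʳᵛ x) ≡ toList xs ∷ʳ x
toList-∷ʳ [] x = refl
toList-∷ʳ (y ∷ xs) x = cong (y ∷_) (toList-∷ʳ xs x)

∷ʳ-preimage : ∀ {m} (σ : Vec ℕ (suc m)) {l x} → toList σ ≡ l ∷ʳ x →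
  ∃ λ τ → σ ≡ τ ∷ʳᵛ x × toList τ ≡ l
∷ʳ-preimage σ eq with Vec.initLast σ
... | τ , y , refl =
  let l≡ , y≡ = ∷ʳ-injective (toList τ) _ (trans (sym (toList-∷ʳ τ y)) eq)
  in τ , cong (τ ∷ʳᵛ_) y≡ , l≡

map-suc-preimage : ∀ {m} (τ : Vec ℕ m) {l} → toList τ ≡ map suc l →
  ∃ λ τ₀ → τ ≡ Vec.map Nat.suc τ₀ × toList τ₀ ≡ l
map-suc-preimage [] {[]} _ = [] , refl , refl
map-suc-preimage (x ∷ τ) {y ∷ l} eq with List.∷-injective eq
... | refl , τ≡ =
  let τ₀ , τ≡′ , l≡ = map-suc-preimage τ τ≡ in y ∷ τ₀ , cong (suc y ∷_) τ≡′ , cong (y ∷_) l≡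

map-suc-injective : ∀ {m} (α β : Vec ℕ m) → Vec.map Nat.suc α ≡ Vec.map Nat.suc β → α ≡ β
map-suc-injective [] [] _ = refl
map-suc-injective (x ∷ α) (y ∷ β) eq =
  cong₂ _∷_ (suc-injective (Vec.∷-injectiveˡ eq)) (map-suc-injective α β (Vec.∷-injectiveʳ eq))

∷-preimage : ∀ {m} (σ : Vec ℕ (suc m)) {x l} → toList σ ≡ x ∷ l →
  ∃ λ τ → σ ≡ x ∷ τ × toList τ ≡ l
∷-preimage (y ∷ τ) eq with List.∷-injective eq
... | refl , τ≡ = τ , refl , τ≡

lastIsNot-∷ʳ : ∀ n l → ¬ LastIsNot n (l ∷ʳ n)
lastIsNot-∷ʳ n [] last≢ = last≢ refl
lastIsNot-∷ʳ n (x ∷ l) last≢ = last≢ (last⁺-∷ʳ x l n)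

max-before-1ᵛ : ∀ {j} → Vec ℕ j → Vec ℕ (suc (suc j))
max-before-1ᵛ {j} α = Vec.map Nat.suc α ∷ʳᵛ suc (suc j) ∷ʳᵛ 1

toList-max-before-1ᵛ : ∀ {j} (α : Vec ℕ j) →
  toList (max-before-1ᵛ α) ≡ map suc (toList α) ∷ʳ suc (suc j) ∷ʳ 1
toList-max-before-1ᵛ {j} α = trans (toList-∷ʳ _ 1)
  (cong (_∷ʳ 1) (trans (toList-∷ʳ _ (suc (suc j))) (cong (_∷ʳ suc (suc j)) (Vec.toList-map suc α))))

max-before-1-preimage : ∀ {j} (σ : Vec ℕ (suc (suc j))) {l} → toList σ ≡ map suc l ∷ʳ suc (suc j) ∷ʳ 1 →
  ∃ λ α → σ ≡ max-before-1ᵛ α × toList α ≡ l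
max-before-1-preimage {j} σ eq =
  let τ₁ , σ≡ , τ₁≡ = ∷ʳ-preimage σ eq
      τ₂ , τ₁≡′ , τ₂≡ = ∷ʳ-preimage τ₁ τ₁≡
      α , τ₂≡′ , α≡ = map-suc-preimage τ₂ τ₂≡
  in α , trans σ≡ (cong (_∷ʳᵛ 1) (trans τ₁≡′ (cong (_∷ʳᵛ suc (suc j)) τ₂≡′))) , α≡

good₁-∷ʳ-max : ∀ {j} (τ : Vec ℕ (suc j)) → Good₂ τ → Good₁ (τ ∷ʳᵛ suc (suc j))
good₁-∷ʳ-max {j} τ g =
  let adm , last≢ = good₂⇒ τ g
      adm′ , head≢ = admissible-max-last j (toList τ) (length-toList τ) adm last≢
  in ⇒good₁ (τ ∷ʳᵛ suc (suc j)) (toList-∷ʳ τ _) adm′ head≢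

good₂-max-∷ : ∀ {j} (β : Vec ℕ (suc j)) → Good₁ β → Good₂ (suc (suc j) ∷ β)
good₂-max-∷ {j} β g =
  let adm , head≢ = good₁⇒ β g
      adm′ , last≢ = admissible-max-first j (toList β) (length-toList β) adm head≢
  in ⇒good₂ (suc (suc j) ∷ β) refl adm′ last≢

good-max-before-1 : ∀ {j} (α : Vec ℕ j) → Good₂ α → Good₁ (max-before-1ᵛ α) × Good₂ (max-before-1ᵛ α)
good-max-before-1 {j} α g =
  let adm , last≢ = good₂⇒ α g
      adm′ , head≢ , last≢′ = admissible-max-before-1 j (toList α) (length-toList α) adm last≢
  in ⇒good₁ (max-before-1ᵛ α) (toList-max-before-1ᵛ α) adm′ head≢ ,
     ⇒good₂ (max-before-1ᵛ α) (toList-max-before-1ᵛ α) adm′ last≢′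

max-∷≢max-before-1ᵛ : ∀ {j} (β : Vec ℕ (suc j)) (α : Vec ℕ j) → Good₂ α →
  suc (suc j) ∷ β ≢ max-before-1ᵛ α
max-∷≢max-before-1ᵛ β α g eq with good₂⇒ α g
max-∷≢max-before-1ᵛ β [] g eq | (_ , _ , ()) , _
max-∷≢max-before-1ᵛ {j} β (a ∷ α) g eq | (ip , _) , _ =
  1+n≰n (subst (_≤ j) a≡ (proj₂ (All.head (perm-bound ip (length-toList (a ∷ α))))))
  where
  a≡ : a ≡ suc j
  a≡ = suc-injective (sym (Vec.∷-injectiveˡ eq))

module _ {j : ℕ} where

  build₁ : Good₂Perms (suc j) ⊎ Good₂Perms j → Good₁Perms (suc (suc j))
  build₁ (inj₁ (τ , g)) = τ ∷ʳᵛ suc (suc j) , good₁-∷ʳ-max τ g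
  build₁ (inj₂ (α , g)) = max-before-1ᵛ α , proj₁ (good-max-before-1 α g)

  build₂ : Good₁Perms (suc j) ⊎ Good₂Perms j → Good₂Perms (suc (suc j))
  build₂ (inj₁ (β , g)) = suc (suc j) ∷ β , good₂-max-∷ β g
  build₂ (inj₂ (α , g)) = max-before-1ᵛ α , proj₂ (good-max-before-1 α g)

  build₁-injective : ∀ {x y} → build₁ x ≡ build₁ y → x ≡ y
  build₁-injective {inj₁ (τ , _)} {inj₁ (τ′ , _)} eq =
    cong inj₁ (Σ-≡-irrelevant T-irrelevant (Vec.∷ʳ-injectiveˡ τ τ′ (cong proj₁ eq)))
  build₁-injective {inj₁ (τ , _)} {inj₂ (α , _)} eq = case Vec.∷ʳ-injectiveʳ τ _ (cong proj₁ eq) of λ ()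
  build₁-injective {inj₂ (α , _)} {inj₁ (τ , _)} eq = case Vec.∷ʳ-injectiveʳ _ τ (cong proj₁ eq) of λ ()
  build₁-injective {inj₂ (α , _)} {inj₂ (α′ , _)} eq =
    cong inj₂ (Σ-≡-irrelevant T-irrelevant (map-suc-injective α α′
      (Vec.∷ʳ-injectiveˡ _ _ (Vec.∷ʳ-injectiveˡ _ _ (cong proj₁ eq)))))

  build₂-injective : ∀ {x y} → build₂ x ≡ build₂ y → x ≡ y
  build₂-injective {inj₁ (β , _)} {inj₁ (β′ , _)} eq =
    cong inj₁ (Σ-≡-irrelevant T-irrelevant (Vec.∷-injectiveʳ (cong proj₁ eq)))
  build₂-injective {inj₁ (β , _)} {inj₂ (α , g)} eq = ⊥-elim (max-∷≢max-before-1ᵛ β α g (cong proj₁ eq))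
  build₂-injective {inj₂ (α , g)} {inj₁ (β , _)} eq =
    ⊥-elim (max-∷≢max-before-1ᵛ β α g (sym (cong proj₁ eq)))
  build₂-injective {inj₂ (α , _)} {inj₂ (α′ , _)} eq =
    cong inj₂ (Σ-≡-irrelevant T-irrelevant (map-suc-injective α α′
      (Vec.∷ʳ-injectiveˡ _ _ (Vec.∷ʳ-injectiveˡ _ _ (cong proj₁ eq)))))

build₁-surjective : ∀ j → 3 ≤ j → ∀ s → ∃ λ x → build₁ {j} x ≡ s
build₁-surjective j 3≤j (σ , g) =
  let adm , head≢ = good₁⇒ σ g in
  from-shape (toList σ) refl head≢ (classify j 3≤j (toList σ) (length-toList σ) adm)
  where
  from-shape : ∀ l → toList σ ≡ l → HeadIsNot (suc (suc j)) l → Shape j l →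
    ∃ λ x → build₁ x ≡ (σ , g)
  from-shape _ _ head≢ (max-first _ _) = ⊥-elim (head≢ refl)
  from-shape _ eq _ (max-last adm last≢) =
    let τ , σ≡ , τ≡ = ∷ʳ-preimage σ eq in
    inj₁ (τ , ⇒good₂ τ τ≡ adm last≢) , Σ-≡-irrelevant T-irrelevant (sym σ≡)
  from-shape _ eq _ (max-before-1 adm last≢) =
    let α , σ≡ , α≡ = max-before-1-preimage σ eq in
    inj₂ (α , ⇒good₂ α α≡ adm last≢) , Σ-≡-irrelevant T-irrelevant (sym σ≡)

build₂-surjective : ∀ j → 3 ≤ j → ∀ s → ∃ λ x → build₂ {j} x ≡ s
build₂-surjective j 3≤j (σ , g) =
  let adm , last≢ = good₂⇒ σ g in
  from-shape (toList σ) refl last≢ (classify j 3≤j (toList σ) (length-toList σ) adm)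
  where
  from-shape : ∀ l → toList σ ≡ l → LastIsNot (suc (suc j)) l → Shape j l →
    ∃ λ x → build₂ x ≡ (σ , g)
  from-shape _ eq _ (max-first adm head≢) =
    let β , σ≡ , β≡ = ∷-preimage σ eq in
    inj₁ (β , ⇒good₁ β β≡ adm head≢) , Σ-≡-irrelevant T-irrelevant (sym σ≡)
  from-shape _ _ last≢ (max-last {α} _ _) = ⊥-elim (lastIsNot-∷ʳ _ α last≢)
  from-shape _ eq _ (max-before-1 adm last≢) =
    let α , σ≡ , α≡ = max-before-1-preimage σ eq in
    inj₂ (α , ⇒good₂ α α≡ adm last≢) , Σ-≡-irrelevant T-irrelevant (sym σ≡)

-- Lengths 3 and 4 by exhaustive search

vectorsOver : List ℕ → (m : ℕ) → List (Vec ℕ m)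
vectorsOver xs zero = [ [] ]
vectorsOver xs (suc m) = cartesianProductWith _∷_ xs (vectorsOver xs m)

∈-vectorsOver : ∀ xs {m} (σ : Vec ℕ m) → (∀ i → lookup σ i ∈ xs) → σ ∈ vectorsOver xs m
∈-vectorsOver xs [] _ = here refl
∈-vectorsOver xs (x ∷ σ) ∈xs = ∈-cartesianProductWith⁺ _∷_ (∈xs zero) (∈-vectorsOver xs σ (∈xs ∘ suc))

isPerm⇒entries∈ : ∀ {n} (σ : Vec ℕ n) → IsPerm σ → ∀ i → lookup σ i ∈ applyUpTo suc n
isPerm⇒entries∈ σ (range , _) i with lookup σ i | range i
... | suc x | _ , x<n = ∈-applyUpTo⁺ suc x<n

module Enumeration {n} (P : Vec ℕ n → Set) (P? : ∀ σ → Dec (P σ))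
  (P-irrelevant : ∀ {σ} (p q : P σ) → p ≡ q) (P⇒isPerm : ∀ {σ} → P σ → IsPerm σ) where

  Complete : ∀ {k} → Vec (Vec ℕ n) k → Set
  Complete t = All (λ σ → P σ → ∃ λ i → lookup t i ≡ σ) (vectorsOver (applyUpTo suc n) n)

  complete? : ∀ {k} (t : Vec (Vec ℕ n) k) → Dec (Complete t)
  complete? t = All.all? (λ σ → P? σ →-dec Fin.any? (λ i → Vec.≡-dec _≟_ (lookup t i) σ)) _

  enumeration : ∀ {k} (t : Vec (Vec ℕ n) k) → (∀ i → P (lookup t i)) →
    (∀ {i i′} → lookup t i ≡ lookup t i′ → i ≡ i′) → Complete t → Σ (Vec ℕ n) P ↔ Fin k
  enumeration t P-t distinct complete = ↔-sym (injective-surjective⇒↔ (λ i → lookup t i , P-t i)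
    (distinct ∘ cong proj₁)
    (λ (σ , p) → let i , eq = All.lookup complete (∈-vectorsOver _ σ (isPerm⇒entries∈ σ (P⇒isPerm p))) p in
                 i , Σ-≡-irrelevant P-irrelevant eq))

module Enumeration₁ {n} = Enumeration {n} Good₁ (λ σ → T? ⌊ good₁-dec σ ⌋) T-irrelevant
  (λ {σ} g → proj₁ (toWitness {a? = good₁-dec σ} g))
module Enumeration₂ {n} = Enumeration {n} Good₂ (λ σ → T? ⌊ good₂-dec σ ⌋) T-irrelevant
  (λ {σ} g → proj₁ (toWitness {a? = good₂-dec σ} g))

good₁-length3 : Good₁Perms 3 ↔ Fin 1
good₁-length3 = Enumeration₁.enumeration t (λ { zero → tt }) (λ { {zero} {zero} _ → refl ; {zero} {suc ()} })
  (from-yes (Enumeration₁.complete? t))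
  where
  t : Vec (Vec ℕ 3) 1
  t = (1 ∷ 2 ∷ 3 ∷ []) ∷ []

good₂-length3 : Good₂Perms 3 ↔ Fin 1
good₂-length3 = Enumeration₂.enumeration t (λ { zero → tt }) (λ { {zero} {zero} _ → refl ; {zero} {suc ()} })
  (from-yes (Enumeration₂.complete? t))
  where
  t : Vec (Vec ℕ 3) 1
  t = (3 ∷ 2 ∷ 1 ∷ []) ∷ []

good₁-length4 : Good₁Perms 4 ↔ Fin 2
good₁-length4 = Enumeration₁.enumeration t (λ { zero → tt ; (suc zero) → tt })
  (λ { {zero} {zero} _ → refl ; {suc zero} {suc zero} _ → refl ; {zero} {suc zero} () ; {suc zero} {zero} () })
  (from-yes (Enumeration₁.complete? t))
  where
  t : Vec (Vec ℕ 4) 2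
  t = (2 ∷ 3 ∷ 4 ∷ 1 ∷ []) ∷ (3 ∷ 2 ∷ 1 ∷ 4 ∷ []) ∷ []

good₂-length4 : Good₂Perms 4 ↔ Fin 2
good₂-length4 = Enumeration₂.enumeration t (λ { zero → tt ; (suc zero) → tt })
  (λ { {zero} {zero} _ → refl ; {suc zero} {suc zero} _ → refl ; {zero} {suc zero} () ; {suc zero} {zero} () })
  (from-yes (Enumeration₂.complete? t))
  where
  t : Vec (Vec ℕ 4) 2
  t = (2 ∷ 3 ∷ 4 ∷ 1 ∷ []) ∷ (4 ∷ 1 ∷ 2 ∷ 3 ∷ []) ∷ []

good₁-step : ∀ j → 3 ≤ j → Good₁Perms (suc (suc j)) ↔ (Good₂Perms (suc j) ⊎ Good₂Perms j)
good₁-step j 3≤j = ↔-sym (injective-surjective⇒↔ build₁ build₁-injective (build₁-surjective j 3≤j))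

good₂-step : ∀ j → 3 ≤ j → Good₂Perms (suc (suc j)) ↔ (Good₁Perms (suc j) ⊎ Good₂Perms j)
good₂-step j 3≤j = ↔-sym (injective-surjective⇒↔ build₂ build₂-injective (build₂-surjective j 3≤j))

counts : ∀ m → (Good₁Perms (3 + m) ↔ Fin (F (1 + m))) × (Good₂Perms (3 + m) ↔ Fin (F (1 + m)))
counts zero = good₁-length3 , good₂-length3
counts (suc zero) = good₁-length4 , good₂-length4
counts (suc (suc m)) =
  ↔-Fin-+ (good₁-step (3 + m) 3≤) (proj₂ (counts (suc m))) (proj₂ (counts m)) ,
  ↔-Fin-+ (good₂-step (3 + m) 3≤) (proj₁ (counts (suc m))) (proj₂ (counts m))
  where
  3≤ : 3 ≤ 3 + m
  3≤ = m≤m+n 3 m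

corollary2 : (n : ℕ) → 3 ≤ n →
    (Σ (Vec ℕ n) Good₁ ↔ Fin (F (n ∸ 2))) × (Σ (Vec ℕ n) Good₂ ↔ Fin (F (n ∸ 2)))
corollary2 (suc (suc (suc m))) (s≤s (s≤s (s≤s _))) = counts m
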